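{- Let $G$ be an $r$-regular graph on $n$ vertices with $r$ odd and $\theta(G)=1$. Let $a\in\{1,\dots,n\}$ and $S=\{1,2,\dots,n+1\}\setminus\{a\}$ be such that $G$ is $S$-magic. Then $a\neq 1$.
   Context: For a finite set $S$ of positive integers with $|S|=|V(G)|$, a graph $G$ is $S$-magic if there is a bijection $f:V(G)\to S$ and a constant $c$ (the $S$-magic constant) with $\sum_{v\in N(u)} f(v)=c$ for every vertex $u$, where $N(u)$ is the set of neighbours of $u$. Let $\alpha(S)=\max S$ and $i(G)=\min \alpha(S)$ over all $S$ for which $G$ is $S$-magic; the distance magic index is $\theta(G)=i(G)-|V(G)|$ (and $\theta(G)=\infty$ if no such $S$ exists). If $\theta(G)=1$, then $G$ is $S$-magic for some $S=\{1,\dots,n+1\}\setminus\{a\}$ with $a\in\{1,\dots,n\}$; $a$ is called the deleted label of $S$. -}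

module Defs where

open import Data.Nat using (ℕ; zero; suc; _⊔_; _<_; _≤_; _≟_)
open import Data.Bool using (Bool; true; false; if_then_else_)
open import Data.Fin using (Fin)
open import Data.Nat.ListAction using (sum)
open import Data.List using (List; map; allFin; length; filter; upTo; foldr)
open import Data.List.Membership.Propositional using (_∈_)
open import Data.List.Relation.Unary.All using (All)
open import Data.List.Relation.Unary.Unique.Propositional using (Unique)
open import Data.Product using (Σ; ∃; _×_)
open import Relation.Binary.PropositionalEquality using (_≡_)
open import Relation.Nullary using (¬_)
open import Relation.Nullary.Decidable using (¬?)
open import Function.Definitions using (Injective)

record Graph (n : ℕ) : Set where
  field
    adj    : Fin n → Fin n → Bool
    sym    : ∀ u v → adj u v ≡ adj v u
    irrefl : ∀ u → adj u u ≡ false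
open Graph public

nbrSum : ∀ {n} → Graph n → (Fin n → ℕ) → Fin n → ℕ
nbrSum G f u = sum (map (λ v → if adj G u v then f v else 0) (allFin _))

degree : ∀ {n} → Graph n → Fin n → ℕ
degree G u = nbrSum G (λ _ → 1) u

Regular : ∀ {n} → ℕ → Graph n → Set
Regular r G = ∀ u → degree G u ≡ r

LabelSet : ℕ → Set
LabelSet n = Σ (List ℕ) λ S → Unique S × All (λ x → 0 < x) S × length S ≡ n

maxL : List ℕ → ℕ
maxL = foldr _⊔_ 0

IsMagic : ∀ {n} → Graph n → List ℕ → Set
IsMagic {n} G S =
  Σ (Fin n → ℕ) λ f →
    Injective _≡_ _≡_ f
    × (∀ v → f v ∈ S)
    × (∀ s → s ∈ S → ∃ λ v → f v ≡ s)
    × ∃ λ c → ∀ u → nbrSum G f u ≡ c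

MagicIndexIs : ∀ {n} → Graph n → ℕ → Set
MagicIndexIs {n} G m =
  (Σ (LabelSet n) λ S → IsMagic G (Data.Product.proj₁ S) × maxL (Data.Product.proj₁ S) ≡ m)
  × (∀ (S : LabelSet n) → IsMagic G (Data.Product.proj₁ S) → m ≤ maxL (Data.Product.proj₁ S))

-- θ(G) = k  (finite case), i.e. i(G) = n + k
ThetaIs : ∀ {n} → Graph n → ℕ → Set
ThetaIs {n} G k = MagicIndexIs G (n Data.Nat.+ k)

deleted : ℕ → ℕ → List ℕ
deleted n a = filter (λ x → ¬? (x ≟ a)) (map suc (upTo (suc n)))

OddN : ℕ → Set
OddN r = ∃ λ k → r ≡ suc (2 Data.Nat.* k)

-- Subtracting 1 from every label turns a labelling by {2, …, n+1} with constant c into a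
-- labelling by {1, …, n} with constant c − r, since every neighbourhood has exactly r
-- vertices.  So deleting the label 1 would give i(G) ≤ n, contradicting θ(G) = 1.
module Submission where

open import Defs
open import Data.Nat using (ℕ; zero; suc; pred; _+_; _∸_; _≤_; _≟_; s≤s; z≤n)
open import Data.Nat.Properties
  using (+-comm; ⊔-lub; m+n∸n≡m; m+1+n≰m; suc-injective; ≤-trans; ≤-pred; +-commutativeSemigroup)
open import Algebra.Properties.CommutativeSemigroup +-commutativeSemigroup using (interchange)
open import Data.Bool using (true; false; if_then_else_)
open import Data.Fin using (Fin)
open import Data.List using (List; []; _∷_; map; allFin; upTo)
open import Data.Nat.ListAction using (sum)
open import Data.List.Properties using (map-cong; length-map; length-upTo)
open import Data.List.Membership.Propositional using (_∈_)
open import Data.List.Membership.Propositional.Properties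
  using (∈-upTo⁺; ∈-upTo⁻; ∈-map⁺; ∈-map⁻; ∈-filter⁺; ∈-filter⁻)
open import Data.List.Relation.Binary.Subset.Propositional using (_⊆_)
open import Data.List.Relation.Unary.All using (All; []; _∷_; universal)
open import Data.List.Relation.Unary.All.Properties using (all-upTo) renaming (map⁺ to All-map⁺)
open import Data.List.Relation.Unary.Unique.Propositional.Properties
  using (upTo⁺) renaming (map⁺ to Unique-map⁺)
open import Data.Product using (∃; _,_)
open import Data.Empty using (⊥-elim)
open import Function using (_∘_)
open import Relation.Binary.PropositionalEquality
  using (_≡_; _≢_; refl; trans; cong; _≗_; module ≡-Reasoning) renaming (sym to ≡-sym)
open import Relation.Nullary.Decidable using (¬?)

sum-map-+ : ∀ {A : Set} (f g : A → ℕ) (xs : List A) →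
            sum (map (λ x → f x + g x) xs) ≡ sum (map f xs) + sum (map g xs)
sum-map-+ f g []       = refl
sum-map-+ f g (x ∷ xs) = trans (cong (f x + g x +_) (sum-map-+ f g xs))
                               (interchange (f x) (g x) _ _)

maxL-lub : ∀ {m} {xs : List ℕ} → All (_≤ m) xs → maxL xs ≤ m
maxL-lub []       = z≤n
maxL-lub (p ∷ ps) = ⊔-lub p (maxL-lub ps)

module _ {n} (G : Graph n) where

  nbrSum-cong : ∀ {f g : Fin n → ℕ} → f ≗ g → ∀ u → nbrSum G f u ≡ nbrSum G g u
  nbrSum-cong f≗g u =
    cong sum (map-cong (λ v → cong (λ t → if adj G u v then t else 0) (f≗g v)) (allFin n))

  nbrSum-suc : ∀ (g : Fin n → ℕ) u → nbrSum G (suc ∘ g) u ≡ nbrSum G g u + degree G u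
  nbrSum-suc g u = begin
    nbrSum G (suc ∘ g) u
      ≡⟨ cong sum (map-cong split (allFin n)) ⟩
    sum (map (λ v → on v (g v) + on v 1) (allFin n))
      ≡⟨ sum-map-+ (λ v → on v (g v)) (λ v → on v 1) (allFin n) ⟩
    nbrSum G g u + degree G u
      ∎
    where
    open ≡-Reasoning
    on : Fin n → ℕ → ℕ
    on v t = if adj G u v then t else 0
    split : ∀ v → on v (suc (g v)) ≡ on v (g v) + on v 1
    split v with adj G u v
    ... | true  = +-comm 1 (g v)
    ... | false = refl

  IsMagic-resp-⊆ : ∀ {S T} → S ⊆ T → T ⊆ S → IsMagic G S → IsMagic G T
  IsMagic-resp-⊆ S⊆T T⊆S (f , inj , mem , surj , const) =
    f , inj , S⊆T ∘ mem , (λ s → surj s ∘ T⊆S) , const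

  IsMagic-pred : ∀ {r S} → Regular r G → IsMagic G (map suc S) → IsMagic G S
  IsMagic-pred {r} {S} reg (f , inj , mem , surj , c , const) =
    g , g-injective , mem′ , surj′ , c ∸ r , const′
    where
    g : Fin n → ℕ
    g = pred ∘ f

    f≗suc∘g : f ≗ suc ∘ g
    f≗suc∘g v with ∈-map⁻ suc (mem v)
    ... | _ , _ , fv≡suc rewrite fv≡suc = refl

    g-injective : ∀ {x y} → g x ≡ g y → x ≡ y
    g-injective {x} {y} gx≡gy =
      inj (trans (f≗suc∘g x) (trans (cong suc gx≡gy) (≡-sym (f≗suc∘g y))))

    mem′ : ∀ v → g v ∈ S
    mem′ v with ∈-map⁻ suc (mem v)
    ... | _ , s∈S , fv≡suc rewrite fv≡suc = s∈S

    surj′ : ∀ s → s ∈ S → ∃ λ v → g v ≡ s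
    surj′ s s∈S with surj (suc s) (∈-map⁺ suc s∈S)
    ... | v , fv≡suc = v , cong pred fv≡suc

    const′ : ∀ u → nbrSum G g u ≡ c ∸ r
    const′ u = begin
      nbrSum G g u                   ≡⟨ ≡-sym (m+n∸n≡m _ r) ⟩
      nbrSum G g u + r ∸ r           ≡⟨ cong (λ d → nbrSum G g u + d ∸ r) (≡-sym (reg u)) ⟩
      nbrSum G g u + degree G u ∸ r  ≡⟨ cong (_∸ r) (≡-sym (nbrSum-suc g u)) ⟩
      nbrSum G (suc ∘ g) u ∸ r       ≡⟨ cong (_∸ r) (≡-sym (nbrSum-cong f≗suc∘g u)) ⟩
      nbrSum G f u ∸ r               ≡⟨ cong (_∸ r) (const u) ⟩
      c ∸ r                          ∎
      where open ≡-Reasoning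

oneTo : ℕ → List ℕ
oneTo n = map suc (upTo n)

oneTo-labelSet : ∀ n → LabelSet n
oneTo-labelSet n =
  oneTo n , Unique-map⁺ suc-injective (upTo⁺ n) , All-map⁺ (universal (λ _ → s≤s z≤n) (upTo n))
          , trans (length-map suc (upTo n)) (length-upTo n)

maxL-oneTo : ∀ n → maxL (oneTo n) ≤ n
maxL-oneTo n = maxL-lub (All-map⁺ (all-upTo n))

deleted-one⊆ : ∀ n → deleted n 1 ⊆ map suc (oneTo n)
deleted-one⊆ n x∈ with ∈-filter⁻ (λ x → ¬? (x ≟ 1)) {xs = oneTo (suc n)} x∈
... | x∈oneTo , x≢1 with ∈-map⁻ suc x∈oneTo
... | zero  , _     , refl = ⊥-elim (x≢1 refl)
... | suc y , y∈upTo , refl = ∈-map⁺ suc (∈-map⁺ suc (∈-upTo⁺ (≤-pred (∈-upTo⁻ y∈upTo))))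

⊆deleted-one : ∀ n → map suc (oneTo n) ⊆ deleted n 1
⊆deleted-one n x∈ with ∈-map⁻ suc x∈
... | _ , y∈oneTo , refl with ∈-map⁻ suc y∈oneTo
... | z , z∈upTo , refl =
  ∈-filter⁺ (λ x → ¬? (x ≟ 1)) (∈-map⁺ suc (∈-upTo⁺ (s≤s (∈-upTo⁻ z∈upTo)))) λ ()

lemma1 : ∀ {n r : ℕ} (G : Graph n) → Regular r G → OddN r → ThetaIs G 1 →
           ∀ (a : ℕ) → 1 ≤ a → a ≤ n → IsMagic G (deleted n a) → a ≢ 1
lemma1 {n} G reg _ (_ , minimal) a _ _ magic refl =
  m+1+n≰m n (≤-trans (minimal (oneTo-labelSet n) oneTo-magic) (maxL-oneTo n))
  where
  oneTo-magic : IsMagic G (oneTo n)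
  oneTo-magic = IsMagic-pred G reg (IsMagic-resp-⊆ G (deleted-one⊆ n) (⊆deleted-one n) magic)
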